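{- For every base $\mathcal{B}$, every finite set $P$ of atoms and every atom $a$: $P \Vdash^{K}_{\mathcal{B}} a$ if and only if $P \vdash_{\mathcal{B}} a$.
   Context: Fix a set $\mathrm{At}$ of atoms. An atomic rule has the form $((P_1 \Rightarrow a_1), \dots, (P_n \Rightarrow a_n) \Rightarrow b)$ with $n \ge 0$, atoms $a_i, b$ and finite sets of atoms $P_i$. A base is a set of atomic rules, ordered by inclusion. Derivability $P \vdash_{\mathcal{B}} a$ (finite set of atoms $P$, atom $a$) is defined inductively by (Ref) $P, a \vdash_{\mathcal{B}} a$ and (App) for a rule $((P_1 \Rightarrow a_1),\dots,(P_n \Rightarrow a_n) \Rightarrow b) \in \mathcal{B}$ and finite $Q$, if $Q, P_i \vdash_{\mathcal{B}} a_i$ for all $i$ then $Q \vdash_{\mathcal{B}} b$ (commas denote union). The Kripke forcing relation on bases is: $\Vdash^K_{\mathcal{B}} a$ iff $\emptyset \vdash_{\mathcal{B}} a$ for atoms $a$ (other connectives interpreted by standard Kripke clauses over the frame of all bases ordered by inclusion). For a nonempty set $P$ of atoms, $P \Vdash^K_{\mathcal{B}} a$ means: for every base $\mathcal{C} \supseteq \mathcal{B}$, if $\Vdash^K_{\mathcal{C}} p$ for all $p \in P$, then $\Vdash^K_{\mathcal{C}} a$; for $P = \emptyset$ it means $\Vdash^K_{\mathcal{B}} a$. -}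

module Defs where

open import Data.List using (List; []; _∷_; _++_)
open import Data.List.Membership.Propositional using (_∈_)
open import Data.List.Relation.Unary.All using (All)
open import Data.Product using (_×_; proj₁; proj₂)

-- Finite sets of atoms are represented by lists (order/multiplicity irrelevant:
-- derivability only uses membership and union `_++_`).

record Rule (At : Set) : Set where
  constructor _⇒_
  field
    premises   : List (List At × At)
    conclusion : At
open Rule public

Base : Set → Set₁
Base At = Rule At → Set

_⊆B_ : {At : Set} → Base At → Base At → Set
B ⊆B C = ∀ r → B r → C r

data _⊢[_]_ {At : Set} : List At → Base At → At → Set₁ where
  ref : ∀ {B P a} → a ∈ P → P ⊢[ B ] a
  app : ∀ {B Q} (r : Rule At) → B r →
        All (λ prem → (Q ++ proj₁ prem) ⊢[ B ] proj₂ prem) (premises r) →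
        Q ⊢[ B ] conclusion r

⊩[_]_ : {At : Set} → Base At → At → Set₁
⊩[ B ] a = [] ⊢[ B ] a

_⊩[_]_ : {At : Set} → List At → Base At → At → Set₁
[]      ⊩[ B ] a = ⊩[ B ] a
(p ∷ P) ⊩[ B ] a = ∀ C → B ⊆B C → (∀ q → q ∈ (p ∷ P) → ⊩[ C ] q) → ⊩[ C ] a

{-# OPTIONS --safe #-}
-- Soundness is cut together with monotonicity of ⊢ in the base. For
-- completeness, extend B by the axioms (⇒ p) for p ∈ P: this extension forces
-- every atom of P, hence derives a from no assumptions, and in a derivation
-- from P each use of an axiom (⇒ p) can be replaced by (Ref).
module Submission where

open import Defs
open import Data.List using (List; []; _∷_; _++_)
open import Data.List.Membership.Propositional using (_∈_)
open import Data.List.Membership.Propositional.Properties using (∈-++⁺ʳ; ∈-++⁻)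
open import Data.List.Relation.Binary.Subset.Propositional using (_⊆_)
open import Data.List.Relation.Binary.Subset.Propositional.Properties
  using (⊆-refl; xs⊆xs++ys; ++⁺ˡ)
open import Data.List.Relation.Unary.All using (All; []; _∷_)
open import Data.Product using (_×_; _,_; proj₁; proj₂)
open import Data.Sum using (_⊎_; inj₁; inj₂)
open import Function.Base using (id)
open import Function.Bundles using (_⇔_; mk⇔)
open import Relation.Binary.PropositionalEquality using (_≡_; refl)

module _ {At : Set} where

  private variable
    B C : Base At
    P Γ Δ : List At
    a : At

  _⊢*[_]_ : List At → Base At → List (List At × At) → Set₁
  Γ ⊢*[ B ] ps = All (λ prem → (Γ ++ proj₁ prem) ⊢[ B ] proj₂ prem) ps

  mutual
    ⊢-weaken : Γ ⊆ Δ → Γ ⊢[ B ] a → Δ ⊢[ B ] a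
    ⊢-weaken Γ⊆Δ (ref a∈Γ)      = ref (Γ⊆Δ a∈Γ)
    ⊢-weaken Γ⊆Δ (app r r∈B ds) = app r r∈B (⊢*-weaken Γ⊆Δ ds)

    ⊢*-weaken : ∀ {ps} → Γ ⊆ Δ → Γ ⊢*[ B ] ps → Δ ⊢*[ B ] ps
    ⊢*-weaken Γ⊆Δ []                     = []
    ⊢*-weaken Γ⊆Δ (_∷_ {x = R , _} d ds) = ⊢-weaken (++⁺ˡ R Γ⊆Δ) d ∷ ⊢*-weaken Γ⊆Δ ds

  mutual
    ⊢-mono : B ⊆B C → Γ ⊢[ B ] a → Γ ⊢[ C ] a
    ⊢-mono B⊆C (ref a∈Γ)      = ref a∈Γ
    ⊢-mono B⊆C (app r r∈B ds) = app r (B⊆C r r∈B) (⊢*-mono B⊆C ds)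

    ⊢*-mono : ∀ {ps} → B ⊆B C → Γ ⊢*[ B ] ps → Γ ⊢*[ C ] ps
    ⊢*-mono B⊆C []       = []
    ⊢*-mono B⊆C (d ∷ ds) = ⊢-mono B⊆C d ∷ ⊢*-mono B⊆C ds

  ⊢-all-++ : ∀ R → (∀ q → q ∈ Γ → Δ ⊢[ B ] q) → ∀ q → q ∈ Γ ++ R → (Δ ++ R) ⊢[ B ] q
  ⊢-all-++ {Γ = Γ} {Δ} R Δ⊢Γ q q∈Γ++R with ∈-++⁻ Γ q∈Γ++R
  ... | inj₁ q∈Γ = ⊢-weaken (xs⊆xs++ys Δ R) (Δ⊢Γ q q∈Γ)
  ... | inj₂ q∈R = ref (∈-++⁺ʳ Δ q∈R)

  mutual
    ⊢-cut : (∀ q → q ∈ Γ → Δ ⊢[ B ] q) → Γ ⊢[ B ] a → Δ ⊢[ B ] a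
    ⊢-cut Δ⊢Γ (ref a∈Γ)      = Δ⊢Γ _ a∈Γ
    ⊢-cut Δ⊢Γ (app r r∈B ds) = app r r∈B (⊢*-cut Δ⊢Γ ds)

    ⊢*-cut : ∀ {ps} → (∀ q → q ∈ Γ → Δ ⊢[ B ] q) → Γ ⊢*[ B ] ps → Δ ⊢*[ B ] ps
    ⊢*-cut Δ⊢Γ []                     = []
    ⊢*-cut Δ⊢Γ (_∷_ {x = R , _} d ds) = ⊢-cut (⊢-all-++ R Δ⊢Γ) d ∷ ⊢*-cut Δ⊢Γ ds

  withAxioms : Base At → List At → Base At
  withAxioms B P r = B r ⊎ (premises r ≡ [] × conclusion r ∈ P)

  ⊆B-withAxioms : B ⊆B withAxioms B P
  ⊆B-withAxioms r = inj₁

  withAxioms-forces : ∀ q → q ∈ P → ⊩[ withAxioms B P ] q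
  withAxioms-forces q q∈P = app ([] ⇒ q) (inj₂ (refl , q∈P)) []

  mutual
    ⊢-withAxioms-elim : P ⊆ Γ → Γ ⊢[ withAxioms B P ] a → Γ ⊢[ B ] a
    ⊢-withAxioms-elim P⊆Γ (ref a∈Γ) = ref a∈Γ
    ⊢-withAxioms-elim P⊆Γ (app r (inj₁ r∈B) ds) = app r r∈B (⊢*-withAxioms-elim P⊆Γ ds)
    ⊢-withAxioms-elim P⊆Γ (app ([] ⇒ _) (inj₂ (refl , a∈P)) []) = ref (P⊆Γ a∈P)

    ⊢*-withAxioms-elim : ∀ {ps} → P ⊆ Γ → Γ ⊢*[ withAxioms B P ] ps → Γ ⊢*[ B ] ps
    ⊢*-withAxioms-elim P⊆Γ []       = []
    ⊢*-withAxioms-elim {Γ = Γ} P⊆Γ (d ∷ ds) =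
      ⊢-withAxioms-elim (λ p∈P → xs⊆xs++ys Γ _ (P⊆Γ p∈P)) d ∷ ⊢*-withAxioms-elim P⊆Γ ds

  Forces : List At → Base At → At → Set₁
  Forces P B a = ∀ C → B ⊆B C → (∀ q → q ∈ P → ⊩[ C ] q) → ⊩[ C ] a

  ⊢⇒Forces : P ⊢[ B ] a → Forces P B a
  ⊢⇒Forces P⊢a C B⊆C ⊩P = ⊢-cut ⊩P (⊢-mono B⊆C P⊢a)

  Forces⇒⊢ : Forces P B a → P ⊢[ B ] a
  Forces⇒⊢ {P} {B} forces =
    ⊢-withAxioms-elim ⊆-refl
      (⊢-weaken (λ ()) (forces (withAxioms B P) ⊆B-withAxioms withAxioms-forces))

lemma7 : {At : Set} (B : Base At) (P : List At) (a : At) →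
    (P ⊩[ B ] a) ⇔ (P ⊢[ B ] a)
lemma7 B []      a = mk⇔ id id
lemma7 B (p ∷ P) a = mk⇔ Forces⇒⊢ ⊢⇒Forces
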